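{- Let $R$ be an integral domain and let $(a_{i,j})_{i\geq 0,\,j\in\mathbb{Z}}$ be an $r$-periodic infinite frieze with values in $R$ all of whose entries are non-zero, where $r$ is the minimal period of the frieze. Then: \begin{itemize} \item the frieze is determined by its quiddity row $(a_{1,j})_{j\in\mathbb{Z}}$, and is obtained from the universal $r$-periodic infinite frieze by specializing each variable $z_j$ to $a_{1,j}$; \item for every $k\geq 1$, the value $s_k = a_{rk,j}-a_{rk-2,j+1}$ does not depend on $j\in\mathbb{Z}$; \item $s_{k+2}=s_1s_{k+1}-s_k$ for all $k\geq 0$, with the convention $s_0=2$. \end{itemize}
   Context: An infinite frieze with values in a commutative ring $R$ is an array $(a_{i,j})_{i\geq 0, j\in\mathbb{Z}}$ of elements of $R$ with $a_{0,j}=1$ for all $j$ and satisfying $a_{i,j}a_{i,j+1}-a_{i-1,j+1}a_{i+1,j}=1$ for all $i\geq1$, $j\in\mathbb{Z}$. Its quiddity row is the row $(a_{1,j})_j$. It is $r$-periodic if $a_{i,j}=a_{i,j+r}$ for all $i,j$. The universal $r$-periodic infinite frieze is the frieze with values in $\mathbb{Z}[z_1,\dots,z_r]$ (indices of $z$ taken modulo $r$) given by $a_{0,j}=1$ and, for $i\geq1$, $a_{i,j}$ equal to the determinant of the $i\times i$ tridiagonal matrix with diagonal entries $z_j,z_{j+1},\dots,z_{j+i-1}$ and all entries on the super- and sub-diagonal equal to $1$. Convention: $a_{ -1,j}=0$. -}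

module Defs where

open import Level using (Level; _⊔_)
open import Algebra.Bundles using (CommutativeRing)
open import Data.Nat using (ℕ; zero; suc; _≤_)
open import Data.Integer using (ℤ) renaming (_+_ to _+ℤ_; +_ to ⁺)
open import Data.Sum using (_⊎_)
open import Data.Product using (_×_)
open import Relation.Nullary using (¬_)

module _ {c ℓ : Level} (R : CommutativeRing c ℓ) where
  open CommutativeRing R

  IsIntegralDomain : Set (c ⊔ ℓ)
  IsIntegralDomain = (¬ (1# ≈ 0#)) × (∀ x y → x * y ≈ 0# → (x ≈ 0#) ⊎ (y ≈ 0#))

  IsInfiniteFrieze : (ℕ → ℤ → Carrier) → Set ℓ
  IsInfiniteFrieze a =
    (∀ j → a 0 j ≈ 1#) ×
    (∀ n j → a (suc n) j * a (suc n) (j +ℤ ⁺ 1) - a n (j +ℤ ⁺ 1) * a (suc (suc n)) j ≈ 1#)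

  IsPeriodic : ℕ → (ℕ → ℤ → Carrier) → Set ℓ
  IsPeriodic r a = ∀ i j → a i (j +ℤ ⁺ r) ≈ a i j

  IsMinimalPeriod : ℕ → (ℕ → ℤ → Carrier) → Set ℓ
  IsMinimalPeriod r a = (1 ≤ r) × IsPeriodic r a × (∀ p → 1 ≤ p → IsPeriodic p a → r ≤ p)

  AllNonZero : (ℕ → ℤ → Carrier) → Set ℓ
  AllNonZero a = ∀ i j → ¬ (a i j ≈ 0#)

  -- Entry a_{n-1, j} (shifted row index), with the convention a_{-1,j} = 0.
  aShift : (ℕ → ℤ → Carrier) → ℕ → ℤ → Carrier
  aShift a zero    j = 0#
  aShift a (suc n) j = a n j

  -- The universal infinite frieze specialised at z_j ↦ z j:
  -- univFrieze z i j = det of the i×i tridiagonal matrix with diagonal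
  -- z j, …, z (j+i-1) and 1's on the off-diagonals, computed by expanding
  -- along the last row (continuant recurrence).
  univFrieze : (ℤ → Carrier) → ℕ → ℤ → Carrier
  univFrieze z zero          j = 1#
  univFrieze z (suc zero)    j = z j
  univFrieze z (suc (suc n)) j =
    z (j +ℤ ⁺ (suc n)) * univFrieze z (suc n) j - univFrieze z n j

{-# OPTIONS --safe #-}
-- Row n+2 of a frieze is determined by rows n and n+1: the frieze rule gives
-- a(n,j+1)·a(n+2,j) in terms of row n+1, and a(n,j+1) ≠ 0 cancels in a domain.
-- The universal frieze is a frieze because its entries are those of the
-- monodromy M(z_j)⋯M(z_{j+n-1}), with M(w) = [[w,-1],[1,0]], whose determinant
-- is 1; its trace is a(n,j) − a(n-2,j+1). If z has period N, the monodromy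
-- over N steps from j+1 is conjugate by M(z_j) to the one from j, so that
-- trace does not depend on j; for N = rk the monodromy is Q^k, Q the monodromy
-- over one period, and Cayley–Hamilton for Q (det Q = 1) gives the recurrence
-- for s_k = tr Q^k.
module Submission where

open import Defs
open import Level using (Level)
open import Algebra.Bundles using (CommutativeRing)
open import Data.Nat using (ℕ; zero; suc; _≤_; _∸_) renaming (_*_ to _*ℕ_)
open import Data.Integer using (ℤ) renaming (_+_ to _+ℤ_; +_ to ⁺)
open import Data.Product using (_×_; Σ)

open import Algebra.Definitions using (AlmostLeftCancellative)
open import Data.Maybe using (Maybe; just; nothing)
open import Data.Nat using () renaming (_+_ to _+ℕ_)
import Data.Nat.Properties as ℕₚ
open import Data.Integer using (-[1+_]; _⊖_)
import Data.Integer as ℤ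
import Data.Integer.Properties as ℤₚ
open import Data.Product using (_,_; proj₁)
open import Data.Sum using (inj₁; inj₂)
open import Data.Empty using (⊥-elim)
open import Relation.Binary.Bundles using (Setoid)
open import Relation.Binary.Structures using (IsEquivalence)
open import Relation.Binary.PropositionalEquality as ≡ using (_≡_)
open import Relation.Nullary using (yes; no)
import Relation.Binary.Reasoning.Setoid as SetoidReasoning

-- The standard ring solver needs coefficients with decidable equality; ℤ,
-- mapped by n ↦ n·1#, provides them in every commutative ring.
module IntegerCoefficientRingSolver {c ℓ : Level} (R : CommutativeRing c ℓ) where
  open CommutativeRing R
  open import Algebra.Properties.Semiring.Mult.TCOptimised semiring
    using (×1-homo-*; ×-homo-+; 1+×) renaming (_×_ to _⋆_)
  open import Algebra.Properties.Ring ring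
    using (-‿involutive; -0#≈0#; -‿distribˡ-*; -‿distribʳ-*; -‿+-comm)
  open import Algebra.Solver.Ring.AlmostCommutativeRing
    using (_-Raw-AlmostCommutative⟶_; fromCommutativeRing)
  open SetoidReasoning setoid

  ⟦_⟧ᶻ : ℤ → Carrier
  ⟦ ⁺ n ⟧ᶻ      = n ⋆ 1#
  ⟦ -[1+ n ] ⟧ᶻ = - (suc n ⋆ 1#)

  1+x-[1+y]≈x-y : ∀ x y → (1# + x) - (1# + y) ≈ x - y
  1+x-[1+y]≈x-y x y = begin
    (1# + x) - (1# + y)     ≈⟨ +-congˡ (-‿+-comm 1# y) ⟨
    (1# + x) + (- 1# - y)   ≈⟨ +-congʳ (+-comm 1# x) ⟩
    (x + 1#) + (- 1# - y)   ≈⟨ +-assoc x 1# _ ⟩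
    x + (1# + (- 1# - y))   ≈⟨ +-congˡ (+-assoc 1# (- 1#) (- y)) ⟨
    x + ((1# - 1#) - y)     ≈⟨ +-congˡ (+-congʳ (-‿inverseʳ 1#)) ⟩
    x + (0# - y)            ≈⟨ +-congˡ (+-identityˡ (- y)) ⟩
    x - y                   ∎

  ⊖-homo : ∀ m n → ⟦ m ⊖ n ⟧ᶻ ≈ m ⋆ 1# - n ⋆ 1#
  ⊖-homo m       zero    = sym (trans (+-congˡ -0#≈0#) (+-identityʳ _))
  ⊖-homo zero    (suc n) = sym (+-identityˡ _)
  ⊖-homo (suc m) (suc n) = begin
    ⟦ suc m ⊖ suc n ⟧ᶻ          ≡⟨ ≡.cong ⟦_⟧ᶻ (ℤₚ.[1+m]⊖[1+n]≡m⊖n m n) ⟩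
    ⟦ m ⊖ n ⟧ᶻ                  ≈⟨ ⊖-homo m n ⟩
    m ⋆ 1# - n ⋆ 1#             ≈⟨ 1+x-[1+y]≈x-y _ _ ⟨
    (1# + m ⋆ 1#) - (1# + n ⋆ 1#) ≈⟨ +-cong (1+× m 1#) (-‿cong (1+× n 1#)) ⟨
    suc m ⋆ 1# - suc n ⋆ 1#     ∎

  +-homo : ∀ i j → ⟦ i ℤ.+ j ⟧ᶻ ≈ ⟦ i ⟧ᶻ + ⟦ j ⟧ᶻ
  +-homo (⁺ m)    (⁺ n)    = ×-homo-+ 1# m n
  +-homo (⁺ m)    -[1+ n ] = ⊖-homo m (suc n)
  +-homo -[1+ m ] (⁺ n)    = trans (⊖-homo n (suc m)) (+-comm _ _)
  +-homo -[1+ m ] -[1+ n ] = begin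
    - (suc (suc (m +ℕ n)) ⋆ 1#)     ≡⟨ ≡.cong (λ k → - (k ⋆ 1#)) (ℕₚ.+-suc (suc m) n) ⟨
    - ((suc m +ℕ suc n) ⋆ 1#)       ≈⟨ -‿cong (×-homo-+ 1# (suc m) (suc n)) ⟩
    - (suc m ⋆ 1# + suc n ⋆ 1#)     ≈⟨ -‿+-comm _ _ ⟨
    - (suc m ⋆ 1#) - (suc n ⋆ 1#)   ∎

  -‿homo : ∀ i → ⟦ ℤ.- i ⟧ᶻ ≈ - ⟦ i ⟧ᶻ
  -‿homo (⁺ zero)  = sym -0#≈0#
  -‿homo (⁺ (suc n)) = refl
  -‿homo -[1+ n ]  = sym (-‿involutive _)

  *-homo : ∀ i j → ⟦ i ℤ.* j ⟧ᶻ ≈ ⟦ i ⟧ᶻ * ⟦ j ⟧ᶻ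
  *-homo (⁺ zero)    (⁺ n)        = sym (zeroˡ _)
  *-homo (⁺ zero)    -[1+ n ]     = sym (zeroˡ _)
  *-homo (⁺ (suc m))   (⁺ n)        =
    trans (reflexive (≡.cong ⟦_⟧ᶻ (ℤₚ.+◃n≡+n (suc m *ℕ n)))) (×1-homo-* (suc m) n)
  *-homo (⁺ (suc m))   -[1+ n ]     =
    trans (-‿cong (×1-homo-* (suc m) (suc n))) (-‿distribʳ-* _ _)
  *-homo -[1+ m ]    (⁺ zero)     rewrite ℕₚ.*-zeroʳ m = sym (zeroʳ _)
  *-homo -[1+ m ]    (⁺ (suc n))    =
    trans (-‿cong (×1-homo-* (suc m) (suc n))) (-‿distribˡ-* _ _)
  *-homo -[1+ m ]    -[1+ n ]     = begin
    ⟦ -[1+ m ] ℤ.* -[1+ n ] ⟧ᶻ           ≡⟨ ≡.cong ⟦_⟧ᶻ (ℤₚ.+◃n≡+n (suc m *ℕ suc n)) ⟩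
    (suc m *ℕ suc n) ⋆ 1#               ≈⟨ ×1-homo-* (suc m) (suc n) ⟩
    suc m ⋆ 1# * (suc n ⋆ 1#)            ≈⟨ -‿involutive _ ⟨
    - - (suc m ⋆ 1# * (suc n ⋆ 1#))      ≈⟨ -‿cong (-‿distribˡ-* _ _) ⟩
    - (- (suc m ⋆ 1#) * (suc n ⋆ 1#))    ≈⟨ -‿distribʳ-* _ _ ⟩
    - (suc m ⋆ 1#) * - (suc n ⋆ 1#)      ∎

  homomorphism : ℤ.+-*-rawRing -Raw-AlmostCommutative⟶ fromCommutativeRing R
  homomorphism = record
    { ⟦_⟧ = ⟦_⟧ᶻ ; +-homo = +-homo ; *-homo = *-homo ; -‿homo = -‿homo
    ; 0-homo = refl ; 1-homo = refl }

  ⟦⟧-≟ : ∀ i j → Maybe (⟦ i ⟧ᶻ ≈ ⟦ j ⟧ᶻ)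
  ⟦⟧-≟ i j with i ℤ.≟ j
  ... | yes ≡.refl = just refl
  ... | no _       = nothing

  open import Algebra.Solver.Ring ℤ.+-*-rawRing (fromCommutativeRing R) homomorphism ⟦⟧-≟ public

module Matrix2 {c ℓ : Level} (R : CommutativeRing c ℓ) where
  open CommutativeRing R
  open IntegerCoefficientRingSolver R using (solve; _:=_; con; _:+_; _:*_; _:-_)
  open SetoidReasoning setoid

  record Mat2 : Set c where
    constructor mat
    field m₁₁ m₁₂ m₂₁ m₂₂ : Carrier
  open Mat2

  infix 4 _≋_
  _≋_ : Mat2 → Mat2 → Set ℓ
  A ≋ B = (m₁₁ A ≈ m₁₁ B) × (m₁₂ A ≈ m₁₂ B) × (m₂₁ A ≈ m₂₁ B) × (m₂₂ A ≈ m₂₂ B)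

  ≋-isEquivalence : IsEquivalence _≋_
  ≋-isEquivalence = record
    { refl  = refl , refl , refl , refl
    ; sym   = λ (p , q , r , s) → sym p , sym q , sym r , sym s
    ; trans = λ (p , q , r , s) (p′ , q′ , r′ , s′) →
                trans p p′ , trans q q′ , trans r r′ , trans s s′
    }

  ≋-setoid : Setoid c ℓ
  ≋-setoid = record { isEquivalence = ≋-isEquivalence }

  open Setoid ≋-setoid public using () renaming (refl to ≋-refl; sym to ≋-sym; trans to ≋-trans)

  𝟙 : Mat2
  𝟙 = mat 1# 0# 0# 1#

  infixl 7 _·_
  _·_ : Mat2 → Mat2 → Mat2
  mat a b c d · mat e f g h = mat (a * e + b * g) (a * f + b * h) (c * e + d * g) (c * f + d * h)

  infixr 8 _^_
  _^_ : Mat2 → ℕ → Mat2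
  A ^ zero  = 𝟙
  A ^ suc k = A · A ^ k

  tr : Mat2 → Carrier
  tr A = m₁₁ A + m₂₂ A

  det : Mat2 → Carrier
  det A = m₁₁ A * m₂₂ A - m₁₂ A * m₂₁ A

  ·-cong : ∀ {A A′ B B′} → A ≋ A′ → B ≋ B′ → A · B ≋ A′ · B′
  ·-cong (a , b , c , d) (e , f , g , h) =
    +-cong (*-cong a e) (*-cong b g) , +-cong (*-cong a f) (*-cong b h) ,
    +-cong (*-cong c e) (*-cong d g) , +-cong (*-cong c f) (*-cong d h)

  ·-congˡ : ∀ {A B B′} → B ≋ B′ → A · B ≋ A · B′
  ·-congˡ = ·-cong ≋-refl

  ·-congʳ : ∀ {A A′ B} → A ≋ A′ → A · B ≋ A′ · B
  ·-congʳ A≋A′ = ·-cong A≋A′ ≋-refl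

  tr-cong : ∀ {A B} → A ≋ B → tr A ≈ tr B
  tr-cong (p , _ , _ , s) = +-cong p s

  det-cong : ∀ {A B} → A ≋ B → det A ≈ det B
  det-cong (p , q , r , s) = +-cong (*-cong p s) (-‿cong (*-cong q r))

  ·-assoc : ∀ A B C → (A · B) · C ≋ A · (B · C)
  ·-assoc (mat a b c d) (mat e f g h) (mat i j k l) =
    entry a b e f g h i k , entry a b e f g h j l , entry c d e f g h i k , entry c d e f g h j l
    where
    entry : ∀ a b e f g h i k →
      (a * e + b * g) * i + (a * f + b * h) * k ≈ a * (e * i + f * k) + b * (g * i + h * k)
    entry = solve 8 (λ a b e f g h i k →
      (a :* e :+ b :* g) :* i :+ (a :* f :+ b :* h) :* k
        := a :* (e :* i :+ f :* k) :+ b :* (g :* i :+ h :* k)) refl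

  ·-identityˡ : ∀ A → 𝟙 · A ≋ A
  ·-identityˡ (mat a b c d) = one-zero a c , one-zero b d , zero-one a c , zero-one b d
    where
    one-zero : ∀ x y → 1# * x + 0# * y ≈ x
    one-zero = solve 2 (λ x y → con (⁺ 1) :* x :+ con (⁺ 0) :* y := x) refl
    zero-one : ∀ x y → 0# * x + 1# * y ≈ y
    zero-one = solve 2 (λ x y → con (⁺ 0) :* x :+ con (⁺ 1) :* y := y) refl

  ·-identityʳ : ∀ A → A · 𝟙 ≋ A
  ·-identityʳ (mat a b c d) = one-zero a b , zero-one a b , one-zero c d , zero-one c d
    where
    one-zero : ∀ x y → x * 1# + y * 0# ≈ x
    one-zero = solve 2 (λ x y → x :* con (⁺ 1) :+ y :* con (⁺ 0) := x) refl
    zero-one : ∀ x y → x * 0# + y * 1# ≈ y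
    zero-one = solve 2 (λ x y → x :* con (⁺ 0) :+ y :* con (⁺ 1) := y) refl

  det-𝟙 : det 𝟙 ≈ 1#
  det-𝟙 = solve 0 (con (⁺ 1) :* con (⁺ 1) :- con (⁺ 0) :* con (⁺ 0) := con (⁺ 1)) refl

  det-· : ∀ A B → det (A · B) ≈ det A * det B
  det-· (mat a b c d) (mat e f g h) = solve 8 (λ a b c d e f g h →
    (a :* e :+ b :* g) :* (c :* f :+ d :* h) :- (a :* f :+ b :* h) :* (c :* e :+ d :* g)
      := (a :* d :- b :* c) :* (e :* h :- f :* g)) refl a b c d e f g h

  tr-·-comm : ∀ A B → tr (A · B) ≈ tr (B · A)
  tr-·-comm (mat a b c d) (mat e f g h) = solve 8 (λ a b c d e f g h →
    (a :* e :+ b :* g) :+ (c :* f :+ d :* h) := (e :* a :+ f :* c) :+ (g :* b :+ h :* d)) refl a b c d e f g h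

  -- Cayley–Hamilton, Q² = tr Q · Q − det Q · 𝟙, multiplied by A and traced.
  cayleyHamilton-tr : ∀ Q A → tr (Q · (Q · A)) ≈ tr Q * tr (Q · A) - det Q * tr A
  cayleyHamilton-tr (mat e f g h) (mat a b c d) = solve 8 (λ a b c d e f g h →
    (e :* (e :* a :+ f :* c) :+ f :* (g :* a :+ h :* c)) :+ (g :* (e :* b :+ f :* d) :+ h :* (g :* b :+ h :* d))
      := (e :+ h) :* ((e :* a :+ f :* c) :+ (g :* b :+ h :* d)) :- (e :* h :- f :* g) :* (a :+ d))
    refl a b c d e f g h

  tr-^-recurrence : ∀ Q → det Q ≈ 1# → ∀ k →
    tr (Q ^ suc (suc k)) ≈ tr Q * tr (Q ^ suc k) - tr (Q ^ k)
  tr-^-recurrence Q detQ≈1 k =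
    trans (cayleyHamilton-tr Q (Q ^ k)) (+-congˡ (-‿cong (trans (*-congʳ detQ≈1) (*-identityˡ _))))

  tr-similar : ∀ {A B C D} → B · D ≋ 𝟙 → D · B ≋ 𝟙 → A · B ≋ B · C → tr A ≈ tr C
  tr-similar {A} {B} {C} {D} BD≋𝟙 DB≋𝟙 AB≋BC = begin
    tr A              ≈⟨ tr-cong (·-identityˡ A) ⟨
    tr (𝟙 · A)        ≈⟨ tr-cong (·-congʳ BD≋𝟙) ⟨
    tr (B · D · A)    ≈⟨ tr-cong (·-assoc B D A) ⟩
    tr (B · (D · A))  ≈⟨ tr-·-comm B (D · A) ⟩
    tr (D · A · B)    ≈⟨ tr-cong (·-assoc D A B) ⟩
    tr (D · (A · B))  ≈⟨ tr-cong (·-congˡ AB≋BC) ⟩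
    tr (D · (B · C))  ≈⟨ tr-cong (·-assoc D B C) ⟨
    tr (D · B · C)    ≈⟨ tr-cong (·-congʳ DB≋𝟙) ⟩
    tr (𝟙 · C)        ≈⟨ tr-cong (·-identityˡ C) ⟩
    tr C              ∎

module _ {a ℓ : Level} (S : Setoid a ℓ) where
  open Setoid S

  HasPeriod : ℕ → (ℤ → Carrier) → Set ℓ
  HasPeriod p f = ∀ i → f (i +ℤ ⁺ p) ≈ f i

  hasPeriod-* : ∀ {p f} → HasPeriod p f → ∀ k → HasPeriod (p *ℕ k) f
  hasPeriod-* {p} {f} per zero    i = reflexive (≡.cong f (begin
    i +ℤ ⁺ (p *ℕ 0)  ≡⟨ ≡.cong (λ n → i +ℤ ⁺ n) (ℕₚ.*-zeroʳ p) ⟩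
    i +ℤ ⁺ 0         ≡⟨ ℤₚ.+-identityʳ i ⟩
    i                ∎))
    where open ≡.≡-Reasoning
  hasPeriod-* {p} {f} per (suc k) i = trans (reflexive (≡.cong f (begin
    i +ℤ ⁺ (p *ℕ suc k)            ≡⟨ ≡.cong (λ n → i +ℤ ⁺ n) (ℕₚ.*-suc p k) ⟩
    i +ℤ (⁺ p +ℤ ⁺ (p *ℕ k))       ≡⟨ ℤₚ.+-assoc i (⁺ p) (⁺ (p *ℕ k)) ⟨
    (i +ℤ ⁺ p) +ℤ ⁺ (p *ℕ k)       ∎)))
    (trans (hasPeriod-* per k (i +ℤ ⁺ p)) (per i))
    where open ≡.≡-Reasoning

  hasPeriod-1⇒constant : ∀ {f} → HasPeriod 1 f → ∀ j → f j ≈ f (⁺ 0)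
  hasPeriod-1⇒constant     per (⁺ zero)        = refl
  hasPeriod-1⇒constant {f} per (⁺ (suc n))     =
    trans (reflexive (≡.cong (λ m → f (⁺ m)) (ℕₚ.+-comm 1 n)))
          (trans (per (⁺ n)) (hasPeriod-1⇒constant per (⁺ n)))
  hasPeriod-1⇒constant     per -[1+ zero ]     = sym (per -[1+ zero ])
  hasPeriod-1⇒constant     per -[1+ (suc n) ]  =
    trans (sym (per -[1+ suc n ])) (hasPeriod-1⇒constant per -[1+ n ])

module Monodromy {c ℓ : Level} (R : CommutativeRing c ℓ) where
  open CommutativeRing R
  open Matrix2 R
  open IntegerCoefficientRingSolver R using (solve; _:=_; con; _:+_; _:*_; :-_; _:-_)
  open import Algebra.Properties.Ring ring using (-0#≈0#)
  open import Algebra.Properties.CommutativeSemigroup ℤₚ.+-commutativeSemigroup using (xy∙z≈xz∙y)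
  module ≈-Reasoning = SetoidReasoning setoid
  module ≋-Reasoning = SetoidReasoning ≋-setoid

  transfer : Carrier → Mat2
  transfer w = mat w (- 1#) 1# 0#

  transfer⁻¹ : Carrier → Mat2
  transfer⁻¹ w = mat 0# 1# (- 1#) w

  transfer-cong : ∀ {v w} → v ≈ w → transfer v ≋ transfer w
  transfer-cong v≈w = v≈w , refl , refl , refl

  transfer-inverseʳ : ∀ w → transfer w · transfer⁻¹ w ≋ 𝟙
  transfer-inverseʳ w =
    solve 1 (λ w → w :* con (⁺ 0) :+ (:- con (⁺ 1)) :* (:- con (⁺ 1)) := con (⁺ 1)) refl w ,
    solve 1 (λ w → w :* con (⁺ 1) :+ (:- con (⁺ 1)) :* w := con (⁺ 0)) refl w ,
    solve 0 (con (⁺ 1) :* con (⁺ 0) :+ con (⁺ 0) :* (:- con (⁺ 1)) := con (⁺ 0)) refl ,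
    solve 1 (λ w → con (⁺ 1) :* con (⁺ 1) :+ con (⁺ 0) :* w := con (⁺ 1)) refl w

  transfer-inverseˡ : ∀ w → transfer⁻¹ w · transfer w ≋ 𝟙
  transfer-inverseˡ w =
    solve 1 (λ w → con (⁺ 0) :* w :+ con (⁺ 1) :* con (⁺ 1) := con (⁺ 1)) refl w ,
    solve 0 (con (⁺ 0) :* (:- con (⁺ 1)) :+ con (⁺ 1) :* con (⁺ 0) := con (⁺ 0)) refl ,
    solve 1 (λ w → (:- con (⁺ 1)) :* w :+ w :* con (⁺ 1) := con (⁺ 0)) refl w ,
    solve 1 (λ w → (:- con (⁺ 1)) :* (:- con (⁺ 1)) :+ w :* con (⁺ 0) := con (⁺ 1)) refl w

  det-transfer : ∀ w → det (transfer w) ≈ 1#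
  det-transfer = solve 1 (λ w → w :* con (⁺ 0) :- (:- con (⁺ 1)) :* con (⁺ 1) := con (⁺ 1)) refl

  ·-transfer : ∀ a b c d w → mat a b c d · transfer w ≋ mat (w * a + b) (- a) (w * c + d) (- c)
  ·-transfer a b c d w = first-column a b , second-column a b , first-column c d , second-column c d
    where
    first-column : ∀ x y → x * w + y * 1# ≈ w * x + y
    first-column x y = solve 3 (λ x y w → x :* w :+ y :* con (⁺ 1) := w :* x :+ y) refl x y w
    second-column : ∀ x y → x * - 1# + y * 0# ≈ - x
    second-column = solve 2 (λ x y → x :* (:- con (⁺ 1)) :+ y :* con (⁺ 0) := :- x) refl

  module _ (z : ℤ → Carrier) where

    monodromy : ℕ → ℤ → Mat2
    monodromy zero    j = 𝟙
    monodromy (suc n) j = monodromy n j · transfer (z (j +ℤ ⁺ n))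

    z-cong : ∀ {i j} → i ≡ j → z i ≈ z j
    z-cong i≡j = reflexive (≡.cong z i≡j)

    univFrieze-suc : ∀ n j →
      univFrieze R z (suc n) j ≈ z (j +ℤ ⁺ n) * univFrieze R z n j - aShift R (univFrieze R z) n j
    univFrieze-suc zero    j = begin
      z j                        ≈⟨ z-cong (ℤₚ.+-identityʳ j) ⟨
      z (j +ℤ ⁺ 0)               ≈⟨ x≈x*1-0 _ ⟩
      z (j +ℤ ⁺ 0) * 1# - 0#     ∎
      where
      open ≈-Reasoning
      x≈x*1-0 : ∀ x → x ≈ x * 1# - 0#
      x≈x*1-0 = solve 1 (λ x → x := x :* con (⁺ 1) :- con (⁺ 0)) refl
    univFrieze-suc (suc n) j = refl

    monodromy-entries : ∀ n j → monodromy (suc n) j ≋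
      mat (univFrieze R z (suc n) j) (- univFrieze R z n j)
          (univFrieze R z n (j +ℤ ⁺ 1)) (- aShift R (univFrieze R z) n (j +ℤ ⁺ 1))
    monodromy-entries zero    j =
      ≋-trans (·-identityˡ _) (z-cong (ℤₚ.+-identityʳ j) , refl , refl , sym -0#≈0#)
    monodromy-entries (suc n) j =
      ≋-trans (·-congʳ (monodromy-entries n j))
        (≋-trans (·-transfer _ _ _ _ _) (refl , refl , lower-left , refl))
      where
      open ≈-Reasoning
      lower-left :
        z (j +ℤ ⁺ (suc n)) * univFrieze R z n (j +ℤ ⁺ 1) - aShift R (univFrieze R z) n (j +ℤ ⁺ 1)
          ≈ univFrieze R z (suc n) (j +ℤ ⁺ 1)
      lower-left = begin
        z (j +ℤ ⁺ (suc n)) * _ - _        ≈⟨ +-congʳ (*-congʳ (z-cong (ℤₚ.+-assoc j (⁺ 1) (⁺ n)))) ⟨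
        z ((j +ℤ ⁺ 1) +ℤ ⁺ n) * _ - _     ≈⟨ univFrieze-suc n (j +ℤ ⁺ 1) ⟨
        univFrieze R z (suc n) (j +ℤ ⁺ 1) ∎

    det-monodromy : ∀ n j → det (monodromy n j) ≈ 1#
    det-monodromy zero    j = det-𝟙
    det-monodromy (suc n) j = begin
      det (monodromy n j · transfer _)         ≈⟨ det-· (monodromy n j) _ ⟩
      det (monodromy n j) * det (transfer _)   ≈⟨ *-cong (det-monodromy n j) (det-transfer _) ⟩
      1# * 1#                                  ≈⟨ *-identityˡ 1# ⟩
      1#                                       ∎
      where open ≈-Reasoning

    univFrieze-isInfiniteFrieze : IsInfiniteFrieze R (univFrieze R z)
    univFrieze-isInfiniteFrieze = (λ _ → refl) , λ n j → begin
      U (suc n) j * U (suc n) (j +ℤ ⁺ 1) - U n (j +ℤ ⁺ 1) * U (suc (suc n)) j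
        ≈⟨ det-shape _ _ _ _ ⟩
      det (mat (U (suc (suc n)) j) (- U (suc n) j) (U (suc n) (j +ℤ ⁺ 1)) (- U n (j +ℤ ⁺ 1)))
        ≈⟨ det-cong (monodromy-entries (suc n) j) ⟨
      det (monodromy (suc (suc n)) j)
        ≈⟨ det-monodromy (suc (suc n)) j ⟩
      1# ∎
      where
      open ≈-Reasoning
      U = univFrieze R z
      det-shape : ∀ a b c d → b * c - d * a ≈ a * - d - (- b) * c
      det-shape = solve 4 (λ a b c d → b :* c :- d :* a := a :* (:- d) :- (:- b) :* c) refl

    transfer-·-monodromy : ∀ n j → transfer (z j) · monodromy n (j +ℤ ⁺ 1) ≋ monodromy (suc n) j
    transfer-·-monodromy zero    j = begin
      transfer (z j) · 𝟙             ≈⟨ ·-identityʳ _ ⟩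
      transfer (z j)                 ≈⟨ transfer-cong (z-cong (ℤₚ.+-identityʳ j)) ⟨
      transfer (z (j +ℤ ⁺ 0))        ≈⟨ ·-identityˡ _ ⟨
      𝟙 · transfer (z (j +ℤ ⁺ 0))    ∎
      where open ≋-Reasoning
    transfer-·-monodromy (suc n) j = begin
      transfer (z j) · (monodromy n (j +ℤ ⁺ 1) · transfer (z ((j +ℤ ⁺ 1) +ℤ ⁺ n)))
        ≈⟨ ·-assoc _ _ _ ⟨
      transfer (z j) · monodromy n (j +ℤ ⁺ 1) · transfer (z ((j +ℤ ⁺ 1) +ℤ ⁺ n))
        ≈⟨ ·-cong (transfer-·-monodromy n j) (transfer-cong (z-cong (ℤₚ.+-assoc j (⁺ 1) (⁺ n)))) ⟩
      monodromy (suc n) j · transfer (z (j +ℤ ⁺ (suc n)))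
        ∎
      where open ≋-Reasoning

    monodromy-+ : ∀ m n j → monodromy (m +ℕ n) j ≋ monodromy m j · monodromy n (j +ℤ ⁺ m)
    monodromy-+ m zero    j rewrite ℕₚ.+-identityʳ m = ≋-sym (·-identityʳ _)
    monodromy-+ m (suc n) j rewrite ℕₚ.+-suc m n = begin
      monodromy (m +ℕ n) j · transfer (z (j +ℤ ⁺ (m +ℕ n)))
        ≈⟨ ·-cong (monodromy-+ m n j) (transfer-cong (z-cong (≡.sym (ℤₚ.+-assoc j (⁺ m) (⁺ n))))) ⟩
      monodromy m j · monodromy n (j +ℤ ⁺ m) · transfer (z ((j +ℤ ⁺ m) +ℤ ⁺ n))
        ≈⟨ ·-assoc _ _ _ ⟩
      monodromy m j · monodromy (suc n) (j +ℤ ⁺ m)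
        ∎
      where open ≋-Reasoning

    univFrieze-trace : ∀ N → 1 ≤ N → ∀ j →
      univFrieze R z N j - aShift R (univFrieze R z) (N ∸ 1) (j +ℤ ⁺ 1) ≈ tr (monodromy N j)
    univFrieze-trace (suc n) _ j = sym (tr-cong (monodromy-entries n j))

    tr-monodromy-shift : ∀ {p} → HasPeriod setoid p z → HasPeriod setoid 1 (λ j → tr (monodromy p j))
    tr-monodromy-shift {p} z-periodic j =
      sym (tr-similar (transfer-inverseʳ (z j)) (transfer-inverseˡ (z j)) (begin
        monodromy p j · transfer (z j)              ≈⟨ ·-congˡ (transfer-cong (z-periodic j)) ⟨
        monodromy (suc p) j                         ≈⟨ transfer-·-monodromy p j ⟨
        transfer (z j) · monodromy p (j +ℤ ⁺ 1)     ∎))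
      where open ≋-Reasoning

    module _ {p : ℕ} (z-periodic : HasPeriod setoid p z) where

      monodromy-periodic : ∀ n j → monodromy n (j +ℤ ⁺ p) ≋ monodromy n j
      monodromy-periodic zero    j = ≋-refl
      monodromy-periodic (suc n) j =
        ·-cong (monodromy-periodic n j)
               (transfer-cong (trans (z-cong (xy∙z≈xz∙y j (⁺ p) (⁺ n))) (z-periodic (j +ℤ ⁺ n))))

      monodromy-* : ∀ k j → monodromy (p *ℕ k) j ≋ monodromy p j ^ k
      monodromy-* zero    j rewrite ℕₚ.*-zeroʳ p = ≋-refl
      monodromy-* (suc k) j rewrite ℕₚ.*-suc p k = begin
        monodromy (p +ℕ p *ℕ k) j                        ≈⟨ monodromy-+ p (p *ℕ k) j ⟩
        monodromy p j · monodromy (p *ℕ k) (j +ℤ ⁺ p)    ≈⟨ ·-congˡ (monodromy-periodic (p *ℕ k) j) ⟩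
        monodromy p j · monodromy (p *ℕ k) j             ≈⟨ ·-congˡ (monodromy-* k j) ⟩
        monodromy p j · monodromy p j ^ k                ∎
        where open ≋-Reasoning

      univFrieze-trace-periodic : ∀ k → 1 ≤ p *ℕ k → ∀ j →
        univFrieze R z (p *ℕ k) j - aShift R (univFrieze R z) (p *ℕ k ∸ 1) (j +ℤ ⁺ 1)
          ≈ tr (monodromy p (⁺ 0) ^ k)
      univFrieze-trace-periodic k 1≤pk j = begin
        univFrieze R z (p *ℕ k) j - aShift R (univFrieze R z) (p *ℕ k ∸ 1) (j +ℤ ⁺ 1)
          ≈⟨ univFrieze-trace (p *ℕ k) 1≤pk j ⟩
        tr (monodromy (p *ℕ k) j)
          ≈⟨ hasPeriod-1⇒constant setoid (tr-monodromy-shift (hasPeriod-* setoid z-periodic k)) j ⟩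
        tr (monodromy (p *ℕ k) (⁺ 0))
          ≈⟨ tr-cong (monodromy-* k (⁺ 0)) ⟩
        tr (monodromy p (⁺ 0) ^ k)
          ∎
        where open ≈-Reasoning

module _ {c ℓ : Level} (R : CommutativeRing c ℓ) where
  open CommutativeRing R
  open import Algebra.Properties.Ring ring using (x[y-z]≈xy-xz; x≈y⇒x∙y⁻¹≈ε; x∙y⁻¹≈ε⇒x≈y)
  open IntegerCoefficientRingSolver R using (solve; _:=_; _:-_)
  open SetoidReasoning setoid

  integralDomain⇒*-almostCancelˡ : IsIntegralDomain R → AlmostLeftCancellative _≈_ 0# _*_
  integralDomain⇒*-almostCancelˡ (_ , noZeroDivisors) x y z x≉0 xy≈xz
    with noZeroDivisors x (y - z) (trans (x[y-z]≈xy-xz x y z) (x≈y⇒x∙y⁻¹≈ε xy≈xz))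
  ... | inj₁ x≈0   = ⊥-elim (x≉0 x≈0)
  ... | inj₂ y-z≈0 = x∙y⁻¹≈ε⇒x≈y y z y-z≈0

  aShift-cong : ∀ {a b} → (∀ i j → a i j ≈ b i j) → ∀ n j → aShift R a n j ≈ aShift R b n j
  aShift-cong a≈b zero    j = refl
  aShift-cong a≈b (suc n) j = a≈b n j

  infiniteFrieze-lowerProduct : ∀ {a} → IsInfiniteFrieze R a → ∀ n j →
    a n (j +ℤ ⁺ 1) * a (suc (suc n)) j ≈ a (suc n) j * a (suc n) (j +ℤ ⁺ 1) - 1#
  infiniteFrieze-lowerProduct (_ , rule) n j = trans (y≈x-[x-y] _ _) (+-congˡ (-‿cong (rule n j)))
    where
    y≈x-[x-y] : ∀ x y → y ≈ x - (x - y)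
    y≈x-[x-y] = solve 2 (λ x y → y := x :- (x :- y)) refl

  infiniteFrieze-unique : IsIntegralDomain R → ∀ {a b} →
    IsInfiniteFrieze R a → IsInfiniteFrieze R b → AllNonZero R a →
    (∀ j → a 1 j ≈ b 1 j) → ∀ i j → a i j ≈ b i j
  infiniteFrieze-unique dom {a} {b} a-frieze b-frieze a≉0 row₁ i = proj₁ (rows i)
    where
    rows : ∀ n → (∀ j → a n j ≈ b n j) × (∀ j → a (suc n) j ≈ b (suc n) j)
    rows zero    = (λ j → trans (proj₁ a-frieze j) (sym (proj₁ b-frieze j))) , row₁
    rows (suc n) with rows n
    ... | rowₙ , rowₙ₊₁ = rowₙ₊₁ , λ j →
      integralDomain⇒*-almostCancelˡ dom _ _ _ (a≉0 n (j +ℤ ⁺ 1)) (begin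
        a n (j +ℤ ⁺ 1) * a (suc (suc n)) j
          ≈⟨ infiniteFrieze-lowerProduct {a = a} a-frieze n j ⟩
        a (suc n) j * a (suc n) (j +ℤ ⁺ 1) - 1#
          ≈⟨ +-congʳ (*-cong (rowₙ₊₁ j) (rowₙ₊₁ (j +ℤ ⁺ 1))) ⟩
        b (suc n) j * b (suc n) (j +ℤ ⁺ 1) - 1#
          ≈⟨ infiniteFrieze-lowerProduct {a = b} b-frieze n j ⟨
        b n (j +ℤ ⁺ 1) * b (suc (suc n)) j
          ≈⟨ *-congʳ (rowₙ (j +ℤ ⁺ 1)) ⟨
        a n (j +ℤ ⁺ 1) * b (suc (suc n)) j
          ∎)

mainTheorem2 : {c ℓ : Level} (R : CommutativeRing c ℓ) → IsIntegralDomain R →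
    (r : ℕ) (a : ℕ → ℤ → CommutativeRing.Carrier R) →
    IsInfiniteFrieze R a → IsMinimalPeriod R r a → AllNonZero R a →
    let open CommutativeRing R in
    (∀ i j → a i j ≈ univFrieze R (λ k → a 1 k) i j) ×
    Σ (ℕ → Carrier) (λ s →
      (s 0 ≈ 1# + 1#) ×
      (∀ k → 1 ≤ k → ∀ j → a (r *ℕ k) j - aShift R a (r *ℕ k ∸ 1) (j +ℤ ⁺ 1) ≈ s k) ×
      (∀ k → s (suc (suc k)) ≈ s 1 * s (suc k) - s k))
mainTheorem2 R dom r a a-frieze (1≤r , a-periodic , _) a≉0 = a≈U , s , refl , s-trace , s-recurrence
  where
  open CommutativeRing R
  open Matrix2 R
  open Monodromy R

  z : ℤ → Carrier
  z = a 1

  a≈U : ∀ i j → a i j ≈ univFrieze R z i j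
  a≈U = infiniteFrieze-unique R dom a-frieze (univFrieze-isInfiniteFrieze z) a≉0 (λ _ → refl)

  Q : Mat2
  Q = monodromy z r (⁺ 0)

  s : ℕ → Carrier
  s k = tr (Q ^ k)

  s-trace : ∀ k → 1 ≤ k → ∀ j → a (r *ℕ k) j - aShift R a (r *ℕ k ∸ 1) (j +ℤ ⁺ 1) ≈ s k
  s-trace k 1≤k j =
    trans (+-cong (a≈U (r *ℕ k) j) (-‿cong (aShift-cong R a≈U (r *ℕ k ∸ 1) (j +ℤ ⁺ 1))))
          (univFrieze-trace-periodic z (a-periodic 1) k (ℕₚ.*-mono-≤ 1≤r 1≤k) j)

  s-recurrence : ∀ k → s (suc (suc k)) ≈ s 1 * s (suc k) - s k
  s-recurrence k = trans (tr-^-recurrence Q (det-monodromy z r (⁺ 0)) k)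
                         (+-congʳ (*-congʳ (tr-cong (≋-sym (·-identityʳ Q)))))
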